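{- Let $n$ be odd and let $f\colon\{0,1\}^m\to\{0,1\}^n$ be a $d$-local function such that $f(\{0,1\}^m)=\{x\in\{0,1\}^n:|x|\ge n/2\}$. Let $I\subseteq[m]$ be an arbitrary set of input bits with $|I|\le n/20$. Then there exists a set $S\subseteq[n]$ of output bits with $|S|=O(|I|)$ such that for every assignment $\rho\in\{0,1\}^I$ that fixes to $1$ at most $(n+1)/2$ output bits, there exists a bit in $S$ that is not fixed to $1$ by $\rho$.
   Context: $|x|$ is Hamming weight. $f$ is $d$-local if each output bit depends on at most $d$ input bits. A partial assignment $\rho$ to a set $I$ of input bits fixes output bit $j$ to $1$ if $f(x)_j=1$ for every $x\in\{0,1\}^m$ with $x_I=\rho$. -}

module Defs where

open import Data.Nat using (ℕ; zero; suc; _+_; _*_; _≤_)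
open import Data.Bool using (Bool; true; false; if_then_else_)
open import Data.Fin using (Fin)
import Data.Fin as F
open import Data.Fin.Subset using (Subset; _∈_; ∣_∣)
open import Data.Product using (Σ; ∃; _×_)
open import Relation.Binary.PropositionalEquality using (_≡_)
open import Function using (_⇔_)

-- bit strings {0,1}^n as functions Fin n → Bool (true = 1)
Bits : ℕ → Set
Bits n = Fin n → Bool

weight : ∀ {n} → Bits n → ℕ
weight {zero}  x = 0
weight {suc n} x = (if x F.zero then 1 else 0) + weight (λ i → x (F.suc i))

Local : ∀ {m n} → ℕ → (Bits m → Bits n) → Set
Local {m} {n} d f = (j : Fin n) → Σ (Subset m) λ D → ∣ D ∣ ≤ d ×
  ((x y : Bits m) → (∀ i → i ∈ D → x i ≡ y i) → f x j ≡ f y j)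

-- f({0,1}^m) = {x ∈ {0,1}^n : |x| ≥ n/2}   (|x| ≥ n/2 written as n ≤ 2|x|)
ImageIsUpperHalf : ∀ {m n} → (Bits m → Bits n) → Set
ImageIsUpperHalf {m} {n} f =
  (y : Bits n) → (∃ λ (x : Bits m) → ∀ j → f x j ≡ y j) ⇔ (n ≤ 2 * weight y)

-- the partial assignment (the values of ρ on I) fixes output bit j to 1
Fixes : ∀ {m n} → (Bits m → Bits n) → Subset m → Bits m → Fin n → Set
Fixes {m} f I ρ j = (x : Bits m) → (∀ i → i ∈ I → x i ≡ ρ i) → f x j ≡ true

FixesAtMost : ∀ {m n} → (Bits m → Bits n) → Subset m → Bits m → ℕ → Set
FixesAtMost {m} {n} f I ρ k =
  (T : Subset n) → (∀ j → j ∈ T → Fixes f I ρ j) → ∣ T ∣ ≤ k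

{-# OPTIONS --safe #-}
module Submission where

-- The set of output bits fixed to 1 by ρ depends only on ρ restricted to I,
-- so at most 2^|I| sets T ⊆ [n] with |T| ≤ K = (n+1)/2 have to be escaped,
-- i.e. each must miss a bit of S.  Averaging shows that some bit lies in at
-- most a fraction K/n of the sets not escaped yet; adding it to S keeps at
-- most that fraction of them.  As 2K² ≤ n² for n ≥ 3, after 2|I| + 2 greedy
-- steps at most 2^|I| · 2^-(|I|+1) < 1 sets remain.

open import Defs
open import Data.Bool using (true; false; if_then_else_)
open import Data.Bool.Properties using (_≟_; T-≡)
open import Data.Fin using (Fin; zero; suc)
open import Data.Fin.Properties using (all?)
open import Data.Fin.Subset using (Subset; _∈_; _∉_; ∣_∣; _∪_; ⁅_⁆; inside; outside)
import Data.Fin.Subset as Subset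
open import Data.Fin.Subset.Properties using (_∈?_; x∈p∪q⁺; x∈⁅x⁆; ∣⁅x⁆∣≡1; ∣⊥∣≡0)
open import Data.List using (List; []; _∷_; [_]; length; map; filter; _++_)
open import Data.List.Properties using (length-map; length-++; length-filter)
open import Data.List.Membership.Propositional using (find) renaming (_∈_ to _∈ₗ_)
open import Data.List.Membership.Propositional.Properties using (∈-map⁺; ∈-filter⁺)
open import Data.List.Relation.Unary.All as All using (All; []; _∷_)
open import Data.List.Relation.Unary.All.Properties using (all-filter; filter⁺)
open import Data.List.Relation.Unary.Any as Any using (Any; here)
open import Data.List.Relation.Unary.Any.Properties using (map⁺; ++⁺ˡ; ++⁺ʳ)
open import Data.Nat using (ℕ; zero; suc; _+_; _*_; _^_; _≤_; _<_; _≤?_; z≤n; s≤s; NonZero)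
open import Data.Nat.Properties
  using ( ≤-refl; ≤-trans; ≤-reflexive; <⇒≤; ≰⇒>; n<1+n; m≤m+n; +-mono-≤; *-monoˡ-≤; *-monoˡ-<
        ; +-monoʳ-≤; n≤1+n; +-suc; *-cancelˡ-<; *-assoc; *-suc; +-comm; +-identityʳ; ^-monoˡ-≤; ^-monoʳ-<; ^-*-assoc; m^n≢0
        ; +-0-commutativeMonoid; *-commutativeSemigroup; module ≤-Reasoning )
open import Data.Nat.Solver using (module +-*-Solver)
open import Data.Product using (Σ; ∃; _×_; _,_)
open import Data.Sum using (inj₁; inj₂)
open import Data.Vec using ([]; _∷_; here; there; tabulate)
import Data.Vec.Functional as Vector
open import Data.Vec.Functional.Properties using (∷-cong)
open import Data.Vec.Properties using (lookup∘tabulate; []=⇒lookup; lookup⇒[]=)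
open import Function using (_∘_; _⇔_; mk⇔; Equivalence)
open import Relation.Binary.PropositionalEquality using (_≡_; _≗_; refl; sym; trans; cong; cong₂; module ≡-Reasoning)
open import Relation.Nullary using (¬_; Dec; yes; no; does; ⌊_⌋)
open import Relation.Nullary.Decidable using (_→-dec_; _×-dec_; toWitness; fromWitness)

open import Algebra.Properties.CommutativeMonoid.Sum +-0-commutativeMonoid
  using (sum; sum-syntax; sum-cong-≗; ∑-distrib-+; sum-replicate-zero)
open import Algebra.Properties.CommutativeSemigroup *-commutativeSemigroup using (interchange)

∑-lowerBound : ∀ {n c} (t : Fin n → ℕ) → (∀ i → c ≤ t i) → n * c ≤ sum t
∑-lowerBound {zero}  t c≤t = z≤n
∑-lowerBound {suc n} t c≤t = +-mono-≤ (c≤t zero) (∑-lowerBound (t ∘ suc) (c≤t ∘ suc))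

minimiser : ∀ {n} (t : Fin (suc n) → ℕ) → ∃ λ j → ∀ i → t j ≤ t i
minimiser {zero} t = zero , λ { zero → ≤-refl }
minimiser {suc n} t with minimiser (t ∘ suc)
... | j , min with t zero ≤? t (suc j)
...   | yes t₀≤ = zero , λ { zero → ≤-refl ; (suc i) → ≤-trans t₀≤ (min i) }
...   | no t₀≰ = suc j , λ { zero → <⇒≤ (≰⇒> t₀≰) ; (suc i) → min i }

∃-below-average : ∀ {n} (t : Fin (suc n) → ℕ) → ∃ λ j → suc n * t j ≤ sum t
∃-below-average t with minimiser t
... | j , min = j , ∑-lowerBound t min

^-distribʳ-* : ∀ m n p → (m * n) ^ p ≡ m ^ p * n ^ p
^-distribʳ-* m n zero    = refl
^-distribʳ-* m n (suc p) = begin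
  m * n * (m * n) ^ p      ≡⟨ cong (m * n *_) (^-distribʳ-* m n p) ⟩
  m * n * (m ^ p * n ^ p)  ≡⟨ interchange m n (m ^ p) (n ^ p) ⟩
  m * m ^ p * (n * n ^ p)  ∎
  where open ≡-Reasoning

exponential-gap : ∀ {a b} .{{_ : NonZero a}} → 2 * a ^ 2 ≤ b ^ 2 →
                  ∀ p → 2 ^ p * a ^ (2 * suc p) < b ^ (2 * suc p)
exponential-gap {a} {b} 2a²≤b² p = begin-strict
  2 ^ p * a ^ (2 * q)  <⟨ *-monoˡ-< (a ^ (2 * q)) {{m^n≢0 a (2 * q)}} (^-monoʳ-< 2 (s≤s (s≤s z≤n)) (n<1+n p)) ⟩
  2 ^ q * a ^ (2 * q)  ≡⟨ cong (2 ^ q *_) (^-*-assoc a 2 q) ⟨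
  2 ^ q * (a ^ 2) ^ q  ≡⟨ ^-distribʳ-* 2 (a ^ 2) q ⟨
  (2 * a ^ 2) ^ q      ≤⟨ ^-monoˡ-≤ q 2a²≤b² ⟩
  (b ^ 2) ^ q          ≡⟨ ^-*-assoc b 2 q ⟩
  b ^ (2 * q)          ∎
  where
  open ≤-Reasoning
  q = suc p

square-gap : ∀ k → 2 * suc (suc k) ^ 2 ≤ suc (2 * suc k) ^ 2
square-gap k = ≤-trans (m≤m+n _ (2 * k * k + 4 * k + 1)) (≤-reflexive (solve 1
  (λ k → con 2 :* ((con 2 :+ k) :* ((con 2 :+ k) :* con 1)) :+ (con 2 :* k :* k :+ con 4 :* k :+ con 1)
      := (con 1 :+ con 2 :* (con 1 :+ k)) :* ((con 1 :+ con 2 :* (con 1 :+ k)) :* con 1))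
  refl k))
  where open +-*-Solver

ratio-step : ∀ {N K a b s} → N * a ≤ b * K → b * (K * K ^ s) < N * (N ^ s) → a * K ^ s < N ^ s
ratio-step {N} {K} {a} {b} {s} Na≤bK bK<N = *-cancelˡ-< N (a * K ^ s) (N ^ s) (begin-strict
  N * (a * K ^ s)  ≡⟨ *-assoc N a (K ^ s) ⟨
  N * a * K ^ s    ≤⟨ *-monoˡ-≤ (K ^ s) Na≤bK ⟩
  b * K * K ^ s    ≡⟨ *-assoc b K (K ^ s) ⟩
  b * (K * K ^ s)  <⟨ bK<N ⟩
  N * N ^ s        ∎)
  where open ≤-Reasoning

∣p∪q∣≤∣p∣+∣q∣ : ∀ {n} (p q : Subset n) → ∣ p ∪ q ∣ ≤ ∣ p ∣ + ∣ q ∣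
∣p∪q∣≤∣p∣+∣q∣ []            []            = z≤n
∣p∪q∣≤∣p∣+∣q∣ (inside ∷ p)  (outside ∷ q) = s≤s (∣p∪q∣≤∣p∣+∣q∣ p q)
∣p∪q∣≤∣p∣+∣q∣ (inside ∷ p)  (inside ∷ q)  = s≤s (≤-trans (∣p∪q∣≤∣p∣+∣q∣ p q) (+-monoʳ-≤ ∣ p ∣ (n≤1+n _)))
∣p∪q∣≤∣p∣+∣q∣ (outside ∷ p) (inside ∷ q)  = ≤-trans (s≤s (∣p∪q∣≤∣p∣+∣q∣ p q)) (≤-reflexive (sym (+-suc _ _)))
∣p∪q∣≤∣p∣+∣q∣ (outside ∷ p) (outside ∷ q) = ∣p∪q∣≤∣p∣+∣q∣ p q

χ : ∀ {n} → Subset n → Fin n → ℕ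
χ p j = if does (j ∈? p) then 1 else 0

∑-χ : ∀ {n} (p : Subset n) → ∑[ j < n ] χ p j ≡ ∣ p ∣
∑-χ []            = refl
∑-χ (inside ∷ p)  = cong suc (∑-χ p)
∑-χ (outside ∷ p) = ∑-χ p

∈-tabulate⇔ : ∀ {n} {P : Fin n → Set} (P? : ∀ j → Dec (P j)) {j} → j ∈ tabulate (λ i → ⌊ P? i ⌋) ⇔ P j
∈-tabulate⇔ P? {j} = mk⇔
  (λ j∈ → toWitness (Equivalence.from T-≡ (trans (sym (lookup∘tabulate _ j)) ([]=⇒lookup j∈))))
  (λ Pj → lookup⇒[]= j _ (trans (lookup∘tabulate _ j) (Equivalence.to T-≡ (fromWitness Pj))))

Escapes : ∀ {n} → Subset n → Subset n → Set
Escapes S T = ∃ λ j → j ∈ S × j ∉ T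

length-filter-∈-∷ : ∀ {n} (j : Fin n) T L → length (filter (j ∈?_) (T ∷ L)) ≡ χ T j + length (filter (j ∈?_) L)
length-filter-∈-∷ j T L with does (j ∈? T)
... | true  = refl
... | false = refl

∑-length-filter-∈ : ∀ {n K} (L : List (Subset n)) → All (λ T → ∣ T ∣ ≤ K) L →
                    ∑[ j < n ] length (filter (j ∈?_) L) ≤ length L * K
∑-length-filter-∈ {n}     []      []            = ≤-reflexive (sum-replicate-zero n)
∑-length-filter-∈ {n} {K} (T ∷ L) (∣T∣≤K ∷ L≤K) = begin
  ∑[ j < n ] length (filter (j ∈?_) (T ∷ L))                 ≡⟨ sum-cong-≗ (λ j → length-filter-∈-∷ j T L) ⟩
  ∑[ j < n ] (χ T j + length (filter (j ∈?_) L))             ≡⟨ ∑-distrib-+ (χ T) (λ j → length (filter (j ∈?_) L)) ⟩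
  ∑[ j < n ] χ T j + ∑[ j < n ] length (filter (j ∈?_) L)    ≡⟨ cong (_+ _) (∑-χ T) ⟩
  ∣ T ∣ + ∑[ j < n ] length (filter (j ∈?_) L)               ≤⟨ +-mono-≤ ∣T∣≤K (∑-length-filter-∈ L L≤K) ⟩
  K + length L * K                                           ∎
  where open ≤-Reasoning

∃-rarely-covered : ∀ {n K} (L : List (Subset (suc n))) → All (λ T → ∣ T ∣ ≤ K) L →
                   ∃ λ j → suc n * length (filter (j ∈?_) L) ≤ length L * K
∃-rarely-covered L L≤K with ∃-below-average (λ j → length (filter (j ∈?_) L))
... | j , below = j , ≤-trans below (∑-length-filter-∈ L L≤K)

greedy-escaping-set : ∀ {n K} s (L : List (Subset (suc n))) → All (λ T → ∣ T ∣ ≤ K) L →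
                      length L * K ^ s < suc n ^ s →
                      Σ (Subset (suc n)) λ S → ∣ S ∣ ≤ s × All (Escapes S) L
greedy-escaping-set {n} zero [] _ _ = Subset.⊥ , ≤-reflexive (∣⊥∣≡0 (suc n)) , []
greedy-escaping-set zero (_ ∷ _) _ (s≤s ())
greedy-escaping-set (suc s) L L≤K few
  with j , sparse ← ∃-rarely-covered L L≤K
  with S , ∣S∣≤s , escapes ← greedy-escaping-set s (filter (j ∈?_) L) (filter⁺ (j ∈?_) L≤K)
                                                 (ratio-step {b = length L} {s = s} sparse few)
  = ⁅ j ⁆ ∪ S , size , All.tabulate escapes′
  where
  size : ∣ ⁅ j ⁆ ∪ S ∣ ≤ suc s
  size = ≤-trans (∣p∪q∣≤∣p∣+∣q∣ ⁅ j ⁆ S) (≤-trans (≤-reflexive (cong (_+ ∣ S ∣) (∣⁅x⁆∣≡1 j))) (s≤s ∣S∣≤s))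
  escapes′ : ∀ {T} → T ∈ₗ L → Escapes (⁅ j ⁆ ∪ S) T
  escapes′ {T} T∈L with j ∈? T
  ... | no j∉T = j , x∈p∪q⁺ (inj₁ (x∈⁅x⁆ j)) , j∉T
  ... | yes j∈T with i , i∈S , i∉T ← All.lookup escapes (∈-filter⁺ (j ∈?_) T∈L j∈T)
    = i , x∈p∪q⁺ (inj₂ i∈S) , i∉T

escaping-set : ∀ k p (L : List (Subset (suc (2 * suc k)))) → All (λ T → ∣ T ∣ ≤ suc (suc k)) L → length L ≤ 2 ^ p →
               Σ (Subset (suc (2 * suc k))) λ S → ∣ S ∣ ≤ 2 * suc p × All (Escapes S) L
escaping-set k p L L≤K L≤2^p = greedy-escaping-set (2 * suc p) L L≤K (begin-strict
  length L * K ^ (2 * suc p)  ≤⟨ *-monoˡ-≤ (K ^ (2 * suc p)) L≤2^p ⟩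
  2 ^ p * K ^ (2 * suc p)     <⟨ exponential-gap (square-gap k) p ⟩
  N ^ (2 * suc p)             ∎)
  where
  open ≤-Reasoning
  K = suc (suc k)
  N = suc (2 * suc k)

Agree : ∀ {m} → Subset m → Bits m → Bits m → Set
Agree I x y = ∀ i → i ∈ I → x i ≡ y i

Agree-sym : ∀ {m} {I : Subset m} {x y} → Agree I x y → Agree I y x
Agree-sym x≈y i i∈I = sym (x≈y i i∈I)

Agree-∷ : ∀ {m s} {I : Subset m} {b x ρ} → (s ≡ true → b ≡ Vector.head ρ) → Agree I x (Vector.tail ρ) →
          Agree (s ∷ I) (Vector._∷_ b x) ρ
Agree-∷ head≡ x≈ρ zero    here        = head≡ refl
Agree-∷ head≡ x≈ρ (suc i) (there i∈I) = x≈ρ i i∈I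

Agree? : ∀ {m} (I : Subset m) x y → Dec (Agree I x y)
Agree? I x y = all? (λ i → i ∈? I →-dec x i ≟ y i)

assignments : ∀ {m} → Subset m → List (Bits m)
assignments []            = [ (λ ()) ]
assignments (inside ∷ I)  = map (Vector._∷_ true) (assignments I) ++ map (Vector._∷_ false) (assignments I)
assignments (outside ∷ I) = map (Vector._∷_ false) (assignments I)

length-assignments : ∀ {m} (I : Subset m) → length (assignments I) ≡ 2 ^ ∣ I ∣
length-assignments []            = refl
length-assignments (outside ∷ I) = trans (length-map _ (assignments I)) (length-assignments I)
length-assignments (inside ∷ I)  = begin
  length (map (Vector._∷_ true) A ++ map (Vector._∷_ false) A)       ≡⟨ length-++ (map (Vector._∷_ true) A) ⟩
  length (map (Vector._∷_ true) A) + length (map (Vector._∷_ false) A) ≡⟨ cong₂ _+_ (length-map _ A) (length-map _ A) ⟩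
  length A + length A                                                ≡⟨ cong (λ l → l + l) (length-assignments I) ⟩
  2 ^ ∣ I ∣ + 2 ^ ∣ I ∣                                              ≡⟨ cong (2 ^ ∣ I ∣ +_) (+-identityʳ _) ⟨
  2 ^ suc ∣ I ∣                                                      ∎
  where
  open ≡-Reasoning
  A = assignments I

assignments-complete : ∀ {m} (I : Subset m) ρ → Any (λ ρ′ → Agree I ρ′ ρ) (assignments I)
assignments-complete []            ρ = here λ ()
assignments-complete (outside ∷ I) ρ = map⁺ (Any.map (Agree-∷ λ ()) (assignments-complete I (Vector.tail ρ)))
assignments-complete (inside ∷ I)  ρ with Vector.head ρ in ρ₀≡
... | true  = ++⁺ˡ (map⁺ (Any.map (Agree-∷ λ _ → sym ρ₀≡) (assignments-complete I (Vector.tail ρ))))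
... | false = ++⁺ʳ _ (map⁺ (Any.map (Agree-∷ λ _ → sym ρ₀≡) (assignments-complete I (Vector.tail ρ))))

∀-Bits? : ∀ {m} {P : Bits m → Set} → (∀ {x y} → x ≗ y → P x → P y) → (∀ x → Dec (P x)) → Dec (∀ x → P x)
∀-Bits? {zero} resp P? with P? (λ ())
... | yes p = yes λ x → resp (λ ()) p
... | no ¬p = no λ ∀P → ¬p (∀P _)
∀-Bits? {suc m} {P} resp P? with ∀-Bits? {P = λ x → P (Vector._∷_ true x) × P (Vector._∷_ false x)}
                                        (λ x≗y (p , q) → resp (∷-cong refl x≗y) p , resp (∷-cong refl x≗y) q)
                                        (λ x → P? _ ×-dec P? _)
... | yes both = yes λ x → resp (∷-cong refl λ _ → refl) (extend (Vector.head x) (both (Vector.tail x)))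
  where
  extend : ∀ b {x} → P (Vector._∷_ true x) × P (Vector._∷_ false x) → P (Vector._∷_ b x)
  extend true  (p , _) = p
  extend false (_ , q) = q
... | no ¬both = no λ ∀P → ¬both λ x → ∀P _ , ∀P _

Local⇒cong : ∀ {m n d} {f : Bits m → Bits n} → Local d f → ∀ {x y} → x ≗ y → f x ≗ f y
Local⇒cong loc x≗y j with _ , _ , depends ← loc j = depends _ _ (λ i _ → x≗y i)

Fixes-resp-Agree : ∀ {m n} {f : Bits m → Bits n} {I ρ ρ′ j} → Agree I ρ ρ′ → Fixes f I ρ j → Fixes f I ρ′ j
Fixes-resp-Agree ρ≈ρ′ fixes x x≈ρ′ = fixes x (λ i i∈I → trans (x≈ρ′ i i∈I) (sym (ρ≈ρ′ i i∈I)))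

module _ {m n d} {f : Bits m → Bits n} (loc : Local d f) (I : Subset m) where

  -- Bits are functions, so locality is what makes Fixes respect pointwise equality.
  fixes? : ∀ ρ j → Dec (Fixes f I ρ j)
  fixes? ρ j = ∀-Bits? resp (λ x → Agree? I x ρ →-dec f x j ≟ true)
    where
    resp : ∀ {x y} → x ≗ y → (Agree I x ρ → f x j ≡ true) → Agree I y ρ → f y j ≡ true
    resp x≗y fixes y≈ρ = trans (sym (Local⇒cong loc x≗y j)) (fixes λ i i∈I → trans (x≗y i) (y≈ρ i i∈I))

  fixedSet : Bits m → Subset n
  fixedSet ρ = tabulate λ j → ⌊ fixes? ρ j ⌋

  ∈-fixedSet⇔ : ∀ {ρ j} → j ∈ fixedSet ρ ⇔ Fixes f I ρ j
  ∈-fixedSet⇔ {ρ} = ∈-tabulate⇔ (fixes? ρ)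

fixed-sets-escape : ∀ k {m d} {f : Bits m → Bits (suc (2 * suc k))} → Local d f → (I : Subset m) →
  Σ (Subset (suc (2 * suc k))) λ S → ∣ S ∣ ≤ 2 * ∣ I ∣ + 2 ×
    ((ρ : Bits m) → FixesAtMost f I ρ (suc (suc k)) → ∃ λ j → j ∈ S × ¬ Fixes f I ρ j)
fixed-sets-escape k {m} {f = f} loc I =
  let S , ∣S∣≤ , escapes = escaping-set k ∣ I ∣ L (all-filter small? fixedSets) L≤2^∣I∣
  in S , ≤-trans ∣S∣≤ (≤-reflexive (trans (*-suc 2 ∣ I ∣) (+-comm 2 _))) , escape escapes
  where
  small? = λ (T : Subset (suc (2 * suc k))) → ∣ T ∣ ≤? suc (suc k)
  fixedSets = map (fixedSet loc I) (assignments I)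
  L = filter small? fixedSets

  L≤2^∣I∣ : length L ≤ 2 ^ ∣ I ∣
  L≤2^∣I∣ = ≤-trans (length-filter small? fixedSets)
                    (≤-reflexive (trans (length-map (fixedSet loc I) (assignments I)) (length-assignments I)))

  escape : ∀ {S} → All (Escapes S) L →
           (ρ : Bits m) → FixesAtMost f I ρ (suc (suc k)) → ∃ λ j → j ∈ S × ¬ Fixes f I ρ j
  escape escapes ρ fixes≤
    with ρ′ , ρ′∈ , ρ′≈ρ ← find (assignments-complete I ρ)
    with j , j∈S , j∉ ← All.lookup escapes
           (∈-filter⁺ small? (∈-map⁺ (fixedSet loc I) ρ′∈)
              (fixes≤ _ λ j j∈ → Fixes-resp-Agree {f = f} ρ′≈ρ (Equivalence.to (∈-fixedSet⇔ loc I {ρ′}) j∈)))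
    = j , j∈S , λ fixes →
        j∉ (Equivalence.from (∈-fixedSet⇔ loc I {ρ′}) (Fixes-resp-Agree {f = f} (Agree-sym ρ′≈ρ) fixes))

mainTheorem12 : Σ ℕ λ C → Σ ℕ λ N₀ →
    (k m d : ℕ) → let n = suc (2 * k) in N₀ ≤ n →
    (f : Bits m → Bits n) → Local d f → ImageIsUpperHalf f →
    (I : Subset m) → 20 * ∣ I ∣ ≤ n →
    Σ (Subset n) λ S → ∣ S ∣ ≤ C * ∣ I ∣ + C ×
      ((ρ : Bits m) → FixesAtMost f I ρ (suc k) →
        ∃ λ (j : Fin n) → j ∈ S × ¬ Fixes f I ρ j)
mainTheorem12 = 2 , 3 , λ where
  zero    _ _ (s≤s ()) _ _ _ _ _
  (suc k) _ _ _        _ loc _ I _ → fixed-sets-escape k loc I
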